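{- In the forward-march model described in the context, for every permutation $\pi$, $d_{FM}(\pi)\ge\frac{b_{FM}(\pi)}{3}$.
   Context: A permutation is $\pi=[\pi_0,\pi_1,\ldots,\pi_n,\pi_{n+1}]$ with $\pi_0=0$, $\pi_{n+1}=n+1$ and $(\pi_1,\ldots,\pi_n)$ a permutation of $\{1,\ldots,n\}$; the identity has $\pi_i=i$ for all $i$. Let $s(\pi)$ be the largest $s\in\{0,\ldots,n+1\}$ with $\pi_k=k$ for all $0\le k\le s$. If $\pi$ is not the identity and $s=s(\pi)$, a forward-march prefix reversal, for some $s+3\le j\le n+1$, gives $[\pi_0,\ldots,\pi_s,\pi_{j-1},\ldots,\pi_{s+1},\pi_j,\ldots,\pi_{n+1}]$; a forward-march prefix transposition, for some $s+2\le j\le n$ and $j<k\le n+1$, gives $[\pi_0,\ldots,\pi_s,\pi_j,\ldots,\pi_{k-1},\pi_{s+1},\ldots,\pi_{j-1},\pi_k,\ldots,\pi_{n+1}]$; $s$ is recomputed after each operation. $d_{FM}(\pi)$ is the minimum number of such operations transforming $\pi$ into the identity. $b_{FM}(\pi)$ is the number of indices $i$ with $s(\pi)\le i\le n$ and $|\pi_{i+1}-\pi_i|\neq1$. -}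

module Defs where

open import Data.Nat using (ℕ; zero; suc; _+_; _*_; _∸_; _≤_; _<_; ∣_-_∣)
open import Data.Nat.Properties using (_≟_)
open import Data.List using (List; []; _∷_; _++_; [_]; take; drop; reverse; map; upTo)
open import Data.List.Relation.Binary.Permutation.Propositional using (_↭_)
open import Relation.Binary.PropositionalEquality using (_≡_)
open import Relation.Nullary using (¬_; yes; no)

-- An (extended) permutation of size n is the list [π₀, π₁, …, πₙ, πₙ₊₁]
-- with π₀ = 0, πₙ₊₁ = n+1 and (π₁,…,πₙ) a permutation of {1,…,n}.
IsPerm : ℕ → List ℕ → Set
IsPerm n p = p ↭ map suc (upTo n)

extend : ℕ → List ℕ → List ℕ
extend n p = 0 ∷ p ++ [ suc n ]

identity : ℕ → List ℕ
identity n = upTo (suc (suc n))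

prefixFixed : ℕ → List ℕ → ℕ
prefixFixed i [] = 0
prefixFixed i (x ∷ xs) with x ≟ i
... | yes _ = suc (prefixFixed (suc i) xs)
... | no _ = 0

-- s(π): the largest s with π_k = k for all 0 ≤ k ≤ s
sFM : List ℕ → ℕ
sFM π = prefixFixed 0 π ∸ 1

slice : ℕ → ℕ → List ℕ → List ℕ
slice a b π = drop a (take b π)

revFM : ℕ → List ℕ → List ℕ
revFM j π = take (suc (sFM π)) π ++ reverse (slice (suc (sFM π)) j π) ++ drop j π

transFM : ℕ → ℕ → List ℕ → List ℕ
transFM j k π = take (suc (sFM π)) π ++ slice j k π ++ slice (suc (sFM π)) j π ++ drop k π

data StepFM (n : ℕ) (π : List ℕ) : List ℕ → Set where
  rev   : ¬ (π ≡ identity n) → (j : ℕ) → sFM π + 3 ≤ j → j ≤ suc n →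
          StepFM n π (revFM j π)
  trans : ¬ (π ≡ identity n) → (j k : ℕ) → sFM π + 2 ≤ j → j ≤ n → j < k → k ≤ suc n →
          StepFM n π (transFM j k π)

data SortsIn (n : ℕ) : List ℕ → ℕ → Set where
  done : SortsIn n (identity n) 0
  step : ∀ {π σ m} → StepFM n π σ → SortsIn n σ m → SortsIn n π (suc m)

breaksFrom : ℕ → List ℕ → ℕ
breaksFrom x [] = 0
breaksFrom x (y ∷ t) with ∣ x - y ∣ ≟ 1
... | yes _ = breaksFrom y t
... | no _ = suc (breaksFrom y t)

breaks : List ℕ → ℕ
breaks [] = 0
breaks (x ∷ t) = breaksFrom x t

-- b_FM(π): number of i with s(π) ≤ i ≤ n and |π_{i+1} - π_i| ≠ 1
bFM : List ℕ → ℕ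
bFM π = breaks (drop (sFM π) π)

-- Call a break of a list an adjacent pair of entries not differing by 1, and
-- write breaks π for their number. The fixed prefix 0, 1, …, s of π has no
-- breaks, so b_FM π = breaks π. A forward-march operation cuts π into at most
-- four blocks and reassembles them (reversing one block for a reversal): cutting
-- removes at most three breaks, reversing a block keeps its inner breaks, and
-- gluing never removes any. Hence one operation lowers breaks by at most 3,
-- and the identity has none. The argument never uses that π is a permutation.
module Submission where

open import Defs
open import Data.Nat using (ℕ; zero; suc; _+_; _*_; _∸_; _≤_; ∣_-_∣; z≤n; s≤s)
open import Data.Nat.Properties
  using (_≟_; ∣-∣-comm; ∣m-m+n∣≡n; +-comm; +-assoc; +-identityʳ; +-suc; *-suc; ≤-reflexive; ≤-trans;
         +-monoˡ-≤; +-monoʳ-≤; m≤m+n; n≤1+n; m+n≤o⇒n≤o; <⇒≤; module ≤-Reasoning)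
open import Data.List using (List; []; _∷_; _++_; [_]; _∷ʳ_; take; drop; reverse; applyUpTo)
open import Data.List.Properties using (++-identityʳ; unfold-reverse; take++drop≡id)
open import Data.Nat.Tactic.RingSolver using (solve-∀)
open import Relation.Binary.PropositionalEquality
  using (_≡_; refl; sym; cong; cong₂; subst; module ≡-Reasoning)
  renaming (trans to ≡-trans)
open import Relation.Nullary using (yes; no; contradiction)

jump : ℕ → ℕ → ℕ
jump x y = breaksFrom x [ y ]

jump≤1 : ∀ x y → jump x y ≤ 1
jump≤1 x y with ∣ x - y ∣ ≟ 1
... | yes _ = z≤n
... | no _ = s≤s z≤n

jump-comm : ∀ x y → jump x y ≡ jump y x
jump-comm x y with ∣ x - y ∣ ≟ 1 | ∣ y - x ∣ ≟ 1
... | yes _ | yes _ = refl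
... | no _  | no _  = refl
... | yes ≡1 | no ≢1 = contradiction (≡-trans (∣-∣-comm y x) ≡1) ≢1
... | no ≢1 | yes ≡1 = contradiction (≡-trans (∣-∣-comm x y) ≡1) ≢1

jump-suc : ∀ x → jump x (suc x) ≡ 0
jump-suc x with ∣ x - suc x ∣ ≟ 1
... | yes _ = refl
... | no ≢1 = contradiction (≡-trans (cong (λ y → ∣ x - y ∣) (+-comm 1 x)) (∣m-m+n∣≡n x 1)) ≢1

breaksFrom-∷ : ∀ x y ys → breaksFrom x (y ∷ ys) ≡ jump x y + breaksFrom y ys
breaksFrom-∷ x y ys with ∣ x - y ∣ ≟ 1
... | yes _ = refl
... | no _ = refl

lastFrom : ℕ → List ℕ → ℕ
lastFrom x [] = x
lastFrom x (y ∷ ys) = lastFrom y ys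

lastFrom-∷ʳ : ∀ x xs y → lastFrom x (xs ∷ʳ y) ≡ y
lastFrom-∷ʳ x [] y = refl
lastFrom-∷ʳ x (z ∷ zs) y = lastFrom-∷ʳ z zs y

seamJump : List ℕ → List ℕ → ℕ
seamJump [] _ = 0
seamJump (x ∷ xs) [] = 0
seamJump (x ∷ xs) (y ∷ ys) = jump (lastFrom x xs) y

seamJump≤1 : ∀ xs ys → seamJump xs ys ≤ 1
seamJump≤1 [] _ = z≤n
seamJump≤1 (x ∷ xs) [] = z≤n
seamJump≤1 (x ∷ xs) (y ∷ ys) = jump≤1 (lastFrom x xs) y

seamJump-∷ʳ : ∀ xs y z zs → seamJump (xs ∷ʳ y) (z ∷ zs) ≡ jump y z
seamJump-∷ʳ [] y z zs = refl
seamJump-∷ʳ (x ∷ xs) y z zs = cong (λ l → jump l z) (lastFrom-∷ʳ x xs y)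

seamJump-reverse : ∀ x xs → seamJump (reverse xs) [ x ] ≡ seamJump [ x ] xs
seamJump-reverse x [] = refl
seamJump-reverse x (y ∷ ys) = begin
  seamJump (reverse (y ∷ ys)) [ x ]  ≡⟨ cong (λ l → seamJump l [ x ]) (unfold-reverse y ys) ⟩
  seamJump (reverse ys ∷ʳ y) [ x ]   ≡⟨ seamJump-∷ʳ (reverse ys) y x [] ⟩
  jump y x                           ≡⟨ jump-comm y x ⟩
  jump x y                           ∎
  where open ≡-Reasoning

breaksFrom-++ : ∀ x xs y ys →
  breaksFrom x (xs ++ y ∷ ys) ≡ breaksFrom x xs + (jump (lastFrom x xs) y + breaksFrom y ys)
breaksFrom-++ x [] y ys = breaksFrom-∷ x y ys
breaksFrom-++ x (z ∷ zs) y ys = begin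
  breaksFrom x (z ∷ zs ++ y ∷ ys)          ≡⟨ breaksFrom-∷ x z (zs ++ y ∷ ys) ⟩
  jump x z + breaksFrom z (zs ++ y ∷ ys)   ≡⟨ cong (jump x z +_) (breaksFrom-++ z zs y ys) ⟩
  jump x z + (breaksFrom z zs + r)         ≡⟨ +-assoc (jump x z) (breaksFrom z zs) r ⟨
  jump x z + breaksFrom z zs + r           ≡⟨ cong (_+ r) (breaksFrom-∷ x z zs) ⟨
  breaksFrom x (z ∷ zs) + r                ∎
  where
  open ≡-Reasoning
  r = jump (lastFrom z zs) y + breaksFrom y ys

breaks-++ : ∀ xs ys → breaks (xs ++ ys) ≡ breaks xs + seamJump xs ys + breaks ys
breaks-++ [] ys = refl
breaks-++ (x ∷ xs) [] = ≡-trans (cong (breaksFrom x) (++-identityʳ xs))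
  (sym (≡-trans (+-identityʳ _) (+-identityʳ _)))
breaks-++ (x ∷ xs) (y ∷ ys) = ≡-trans (breaksFrom-++ x xs y ys) (sym (+-assoc (breaksFrom x xs) _ _))

breaks-++-≤ : ∀ xs ys → breaks (xs ++ ys) ≤ suc (breaks xs + breaks ys)
breaks-++-≤ xs ys = begin
  breaks (xs ++ ys)          ≡⟨ breaks-++ xs ys ⟩
  a + seamJump xs ys + b     ≤⟨ +-monoˡ-≤ b (+-monoʳ-≤ a (seamJump≤1 xs ys)) ⟩
  a + 1 + b                  ≡⟨ cong (_+ b) (+-comm a 1) ⟩
  suc (a + b)                ∎
  where
  open ≤-Reasoning
  a = breaks xs
  b = breaks ys

breaks-++-≥ : ∀ xs ys → breaks xs + breaks ys ≤ breaks (xs ++ ys)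
breaks-++-≥ xs ys = begin
  breaks xs + breaks ys                   ≤⟨ +-monoˡ-≤ (breaks ys) (m≤m+n (breaks xs) (seamJump xs ys)) ⟩
  breaks xs + seamJump xs ys + breaks ys  ≡⟨ breaks-++ xs ys ⟨
  breaks (xs ++ ys)                       ∎
  where open ≤-Reasoning

breaks-reverse : ∀ xs → breaks (reverse xs) ≡ breaks xs
breaks-reverse [] = refl
breaks-reverse (x ∷ xs) = begin
  breaks (reverse (x ∷ xs))                            ≡⟨ cong breaks (unfold-reverse x xs) ⟩
  breaks (reverse xs ++ [ x ])                         ≡⟨ breaks-++ (reverse xs) [ x ] ⟩
  breaks (reverse xs) + seamJump (reverse xs) [ x ] + 0
    ≡⟨ cong₂ (λ a b → a + b + 0) (breaks-reverse xs) (seamJump-reverse x xs) ⟩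
  breaks xs + seamJump [ x ] xs + 0                    ≡⟨ +-identityʳ _ ⟩
  breaks xs + seamJump [ x ] xs                        ≡⟨ +-comm (breaks xs) _ ⟩
  seamJump [ x ] xs + breaks xs                        ≡⟨ breaks-++ [ x ] xs ⟨
  breaks (x ∷ xs)                                      ∎
  where open ≡-Reasoning

breaks-applyUpTo-consecutive : (f : ℕ → ℕ) → (∀ i → f (suc i) ≡ suc (f i)) →
  ∀ m → breaks (applyUpTo f m) ≡ 0
breaks-applyUpTo-consecutive f f-suc zero = refl
breaks-applyUpTo-consecutive f f-suc (suc zero) = refl
breaks-applyUpTo-consecutive f f-suc (suc (suc m)) =
  ≡-trans (breaksFrom-∷ (f 0) (f 1) (applyUpTo (λ i → f (suc (suc i))) m))
        (cong₂ _+_ (≡-trans (cong (jump (f 0)) (f-suc 0)) (jump-suc (f 0)))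
                   (breaks-applyUpTo-consecutive (λ i → f (suc i)) (λ i → f-suc (suc i)) (suc m)))

breaks-identity : ∀ n → breaks (identity n) ≡ 0
breaks-identity n = breaks-applyUpTo-consecutive (λ i → i) (λ _ → refl) (suc (suc n))

breaks-drop-prefixFixed : ∀ i xs → breaks (drop (prefixFixed i xs ∸ 1) xs) ≡ breaks xs
breaks-drop-prefixFixed i [] = refl
breaks-drop-prefixFixed i (x ∷ xs) with x ≟ i
... | no _ = refl
breaks-drop-prefixFixed i (x ∷ []) | yes refl = refl
breaks-drop-prefixFixed i (x ∷ y ∷ ys) | yes refl
  with y ≟ suc x | breaks-drop-prefixFixed (suc x) (y ∷ ys)
... | no _ | _ = refl
... | yes refl | ih = ≡-trans ih (sym (≡-trans (breaksFrom-∷ x (suc x) ys)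
                                           (cong (_+ breaksFrom (suc x) ys) (jump-suc x))))

bFM≡breaks : ∀ π → bFM π ≡ breaks π
bFM≡breaks = breaks-drop-prefixFixed 0

slice-++-drop : ∀ j k (xs : List ℕ) → j ≤ k → slice j k xs ++ drop k xs ≡ drop j xs
slice-++-drop zero k xs z≤n = take++drop≡id k xs
slice-++-drop (suc j) (suc k) [] (s≤s _) = refl
slice-++-drop (suc j) (suc k) (x ∷ xs) (s≤s j≤k) = slice-++-drop j k xs j≤k

take-++-slice-++-drop : ∀ j k (xs : List ℕ) → j ≤ k →
  take j xs ++ slice j k xs ++ drop k xs ≡ xs
take-++-slice-++-drop j k xs j≤k =
  ≡-trans (cong (take j xs ++_) (slice-++-drop j k xs j≤k)) (take++drop≡id j xs)

breaks-reverse-middle : ∀ as bs cs →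
  breaks (as ++ bs ++ cs) ≤ 2 + breaks (as ++ reverse bs ++ cs)
breaks-reverse-middle as bs cs = begin
  breaks (as ++ bs ++ cs)                 ≤⟨ breaks-++-≤ as (bs ++ cs) ⟩
  suc (a + breaks (bs ++ cs))             ≤⟨ s≤s (+-monoʳ-≤ a (breaks-++-≤ bs cs)) ⟩
  suc (a + suc (b + c))                   ≡⟨ cong suc (+-suc a (b + c)) ⟩
  2 + (a + (b + c))                       ≡⟨ cong (λ x → 2 + (a + (x + c))) (breaks-reverse bs) ⟨
  2 + (a + (breaks (reverse bs) + c))     ≤⟨ +-monoʳ-≤ 2 (+-monoʳ-≤ a (breaks-++-≥ (reverse bs) cs)) ⟩
  2 + (a + breaks (reverse bs ++ cs))     ≤⟨ +-monoʳ-≤ 2 (breaks-++-≥ as (reverse bs ++ cs)) ⟩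
  2 + breaks (as ++ reverse bs ++ cs)     ∎
  where
  open ≤-Reasoning
  a = breaks as
  b = breaks bs
  c = breaks cs

breaks-swap-middle : ∀ as bs ds cs →
  breaks (as ++ bs ++ ds ++ cs) ≤ 3 + breaks (as ++ ds ++ bs ++ cs)
breaks-swap-middle as bs ds cs = begin
  breaks (as ++ bs ++ ds ++ cs)           ≤⟨ breaks-++-≤ as (bs ++ ds ++ cs) ⟩
  suc (a + breaks (bs ++ ds ++ cs))       ≤⟨ s≤s (+-monoʳ-≤ a (breaks-++-≤ bs (ds ++ cs))) ⟩
  suc (a + suc (b + breaks (ds ++ cs)))   ≤⟨ s≤s (+-monoʳ-≤ a (s≤s (+-monoʳ-≤ b (breaks-++-≤ ds cs)))) ⟩
  suc (a + suc (b + suc (d + c)))         ≡⟨ regroup a b d c ⟩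
  3 + (a + (d + (b + c)))                 ≤⟨ +-monoʳ-≤ 3 (+-monoʳ-≤ a (+-monoʳ-≤ d (breaks-++-≥ bs cs))) ⟩
  3 + (a + (d + breaks (bs ++ cs)))       ≤⟨ +-monoʳ-≤ 3 (+-monoʳ-≤ a (breaks-++-≥ ds (bs ++ cs))) ⟩
  3 + (a + breaks (ds ++ bs ++ cs))       ≤⟨ +-monoʳ-≤ 3 (breaks-++-≥ as (ds ++ bs ++ cs)) ⟩
  3 + breaks (as ++ ds ++ bs ++ cs)       ∎
  where
  open ≤-Reasoning
  a = breaks as
  b = breaks bs
  c = breaks cs
  d = breaks ds
  regroup : ∀ w x y z → suc (w + suc (x + suc (y + z))) ≡ 3 + (w + (y + (x + z)))
  regroup = solve-∀

breaks-StepFM : ∀ {n π σ} → StepFM n π σ → breaks π ≤ 3 + breaks σ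
breaks-StepFM {π = π} (rev _ j s+3≤j _) =
  subst (λ l → breaks l ≤ 3 + breaks (revFM j π))
        (take-++-slice-++-drop (suc s) j π (m+n≤o⇒n≤o 2 (subst (_≤ j) (+-comm s 3) s+3≤j)))
        (≤-trans (breaks-reverse-middle (take (suc s) π) (slice (suc s) j π) (drop j π))
                 (n≤1+n _))
  where s = sFM π
breaks-StepFM {π = π} (trans _ j k s+2≤j _ j<k _) =
  subst (λ l → breaks l ≤ 3 + breaks (transFM j k π)) π≡blocks
        (breaks-swap-middle (take (suc s) π) (slice (suc s) j π) (slice j k π) (drop k π))
  where
  s = sFM π
  π≡blocks : take (suc s) π ++ slice (suc s) j π ++ slice j k π ++ drop k π ≡ π
  π≡blocks =
    ≡-trans (cong (λ l → take (suc s) π ++ slice (suc s) j π ++ l) (slice-++-drop j k π (<⇒≤ j<k)))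
          (take-++-slice-++-drop (suc s) j π (m+n≤o⇒n≤o 1 (subst (_≤ j) (+-comm s 2) s+2≤j)))

breaks-SortsIn : ∀ {n π m} → SortsIn n π m → breaks π ≤ 3 * m
breaks-SortsIn {n} done = ≤-reflexive (breaks-identity n)
breaks-SortsIn {π = π} {m = suc m} (step {σ = σ} st rest) = begin
  breaks π          ≤⟨ breaks-StepFM st ⟩
  3 + breaks σ      ≤⟨ +-monoʳ-≤ 3 (breaks-SortsIn rest) ⟩
  3 + 3 * m         ≡⟨ *-suc 3 m ⟨
  3 * suc m         ∎
  where open ≤-Reasoning

theorem6 : (n : ℕ) (p : List ℕ) → IsPerm n p →
    (m : ℕ) → SortsIn n (extend n p) m → bFM (extend n p) ≤ 3 * m
theorem6 n p _ m sorts =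
  subst (_≤ 3 * m) (sym (bFM≡breaks (extend n p))) (breaks-SortsIn sorts)
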